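{- For every $n\ge 3$: (i) $f(n,3,\{P_3,\vee_2,\wedge_2\})\ge 2^{n-2}$; (ii) $F(n,4,D_2)=f(n,4,D_2)=2^{n-2}$.
   Context: $B_n$ is the Boolean lattice $2^{[n]}$ ordered by inclusion. For a finite poset $P$, a family $\mathcal G\subseteq B_n$ is a (strong) copy of $P$ if there is a bijection $i:P\to\mathcal G$ with $p\le_P q$ if and only if $i(p)\subseteq i(q)$. For a (partial) coloring of $B_n$, a copy is rainbow if all its members are colored with pairwise distinct colors. For a positive integer $l$ and a poset $P$ (or family $\mathcal P$ of posets), $F(n,l,P)$ is the maximum $m$ such that there is a coloring $c:B_n\to[l]$ of all sets admitting no rainbow strong copy of $P$ (of any member of $\mathcal P$) with every color class $c^{ -1}(\{i\})$, $i\in[l]$, of size at least $m$; $f(n,l,P)$ is defined in the same way but allowing partial colorings. $P_3$ is the $3$-element chain; $\vee_2$ is the poset on $a,b_1,b_2$ with $a<b_1,a<b_2$, $b_1,b_2$ incomparable; $\wedge_2$ is the poset on $a,b_1,b_2$ with $b_1<a,b_2<a$, $b_1,b_2$ incomparable; $D_2$ (the diamond) is the poset on $a,b,c,d$ with $a<b<d$, $a<c<d$ and $b,c$ incomparable. -}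

module Defs where

open import Data.Nat using (ℕ; zero; suc; _≤_)
open import Data.Fin using (Fin; zero; suc)
import Data.Fin as F
open import Data.Fin.Subset using (Subset; _⊆_; inside; outside)
open import Data.Vec using (_∷_; [])
open import Data.List using (List; []; _∷_; _++_; map; filter; length)
open import Data.Maybe using (Maybe; just; nothing)
open import Data.Maybe.Properties using (≡-dec)
open import Data.Product using (Σ; ∃; _×_; _,_)
open import Data.Empty using (⊥)
open import Data.Unit using (⊤)
open import Relation.Binary.PropositionalEquality using (_≡_; _≢_)
open import Relation.Nullary using (¬_)
open import Function.Bundles using (_⇔_)

-- B_n: all subsets of [n] (represented as Subset n = Vec Side n), listed once each.
allSubsets : (n : ℕ) → List (Subset n)
allSubsets zero = [] ∷ []
allSubsets (suc n) = map (inside ∷_) (allSubsets n) ++ map (outside ∷_) (allSubsets n)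

record FinPoset : Set₁ where
  field
    size : ℕ
    _≤P_ : Fin size → Fin size → Set
open FinPoset public

-- Partial coloring of B_n with colors [l] (nothing = uncolored).
PartialColoring : ℕ → ℕ → Set
PartialColoring n l = Subset n → Maybe (Fin l)

Coloring : ℕ → ℕ → Set
Coloring n l = Subset n → Fin l

toPartial : ∀ {n l} → Coloring n l → PartialColoring n l
toPartial c S = just (c S)

record StrongCopy (n : ℕ) (P : FinPoset) : Set where
  field
    emb  : Fin (size P) → Subset n
    inj  : ∀ p q → emb p ≡ emb q → p ≡ q
    ord  : ∀ p q → (_≤P_ P p q ⇔ (emb p ⊆ emb q))
open StrongCopy public

Rainbow : ∀ {n l P} → PartialColoring n l → StrongCopy n P → Set
Rainbow {P = P} c G =
  Σ (Fin (size P) → Fin _) λ col →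
    (∀ p → c (emb G p) ≡ just (col p)) × (∀ p q → p ≢ q → col p ≢ col q)

NoRainbow : ∀ {n l} → List FinPoset → PartialColoring n l → Set
NoRainbow [] c = ⊤
NoRainbow {n} (P ∷ 𝒫) c = ((G : StrongCopy n P) → ¬ Rainbow c G) × NoRainbow 𝒫 c

classSize : ∀ {n l} → PartialColoring n l → Fin l → ℕ
classSize {n} c j = length (filter (λ S → ≡-dec F._≟_ (c S) (just j)) (allSubsets n))

AllClassesAtLeast : ∀ {n l} → PartialColoring n l → ℕ → Set
AllClassesAtLeast {l = l} c m = (j : Fin l) → m ≤ classSize c j

-- m is admissible for f(n,l,𝒫): some partial coloring with no rainbow copy, all classes ≥ m.
fAdmissible : ℕ → ℕ → List FinPoset → ℕ → Set
fAdmissible n l 𝒫 m = Σ (PartialColoring n l) λ c → NoRainbow 𝒫 c × AllClassesAtLeast c m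

-- m is admissible for F(n,l,𝒫): the same with a coloring of all sets.
FAdmissible : ℕ → ℕ → List FinPoset → ℕ → Set
FAdmissible n l 𝒫 m = Σ (Coloring n l) λ c → NoRainbow 𝒫 (toPartial c) × AllClassesAtLeast (toPartial c) m

-- f(n,l,𝒫) = m  (m is the maximum admissible value)
fIs : ℕ → ℕ → List FinPoset → ℕ → Set
fIs n l 𝒫 m = fAdmissible n l 𝒫 m × (∀ k → fAdmissible n l 𝒫 k → k ≤ m)

FIs : ℕ → ℕ → List FinPoset → ℕ → Set
FIs n l 𝒫 m = FAdmissible n l 𝒫 m × (∀ k → FAdmissible n l 𝒫 k → k ≤ m)

chain3≤ : Fin 3 → Fin 3 → Set
chain3≤ p q = F.toℕ p ≤ F.toℕ q

P3 : FinPoset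
P3 = record { size = 3 ; _≤P_ = chain3≤ }

-- ∨_2: a = 0, b₁ = 1, b₂ = 2, with a < b₁, a < b₂.
vee≤ : Fin 3 → Fin 3 → Set
vee≤ zero _ = ⊤
vee≤ (suc zero) (suc zero) = ⊤
vee≤ (suc (suc zero)) (suc (suc zero)) = ⊤
vee≤ _ _ = ⊥

Vee2 : FinPoset
Vee2 = record { size = 3 ; _≤P_ = vee≤ }

wedge≤ : Fin 3 → Fin 3 → Set
wedge≤ p q = vee≤ q p

Wedge2 : FinPoset
Wedge2 = record { size = 3 ; _≤P_ = wedge≤ }

-- D_2: a = 0, b = 1, c = 2, d = 3 with a < b < d, a < c < d.
diamond≤ : Fin 4 → Fin 4 → Set
diamond≤ zero _ = ⊤
diamond≤ _ (suc (suc (suc zero))) = ⊤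
diamond≤ (suc zero) (suc zero) = ⊤
diamond≤ (suc (suc zero)) (suc (suc zero)) = ⊤
diamond≤ _ _ = ⊥

D2 : FinPoset
D2 = record { size = 4 ; _≤P_ = diamond≤ }

module Submission where

-- All colourings used here depend only on the trace S ∩ {1,2,3}
-- of a set S ⊆ [n]: a colouring g of B_3 is lifted to B_n by S ↦ g (take 3 S).
--   * Restriction to the first k coordinates is monotone, so the traces of a
--     rainbow strong copy of P form an order-preserving family in B_k whose
--     g-colours are defined and pairwise distinct.  If every order-preserving
--     family in B_k has a "clash" (an uncoloured member or two members of equal
--     colour), the lifted colouring has no rainbow copy of P.  For k = 3 this
--     is a finite check, discharged by a decision procedure.
--   * A colour class of the lifted colouring is 2^(n-k) times the corresponding
--     class in B_k; in B_3 every class of our colourings has exactly 2 sets.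
--   * Conversely, l colour classes of size ≥ k are disjoint, so l · k ≤ 2^n;
--     for l = 4 this gives the matching upper bound 2^(n-2) for D_2.

open import Defs
open import Level using (0ℓ)
open import Function using (_∘_)
open import Function.Bundles using (Equivalence)
open import Data.Nat using (ℕ; zero; suc; _+_; _*_; _^_; _∸_; _≤_; z≤n; s≤s)
open import Data.Nat.Properties
  using (≤-reflexive; +-mono-≤; +-suc; +-identityʳ; *-identityˡ;
         *-distribʳ-+; *-assoc; *-cancelˡ-≤; module ≤-Reasoning)
open import Data.Bool using (true; false)
open import Data.Fin using (Fin; zero; suc; #_; _≟_)
open import Data.Fin.Properties using (any?)
open import Data.Fin.Subset using (Subset; _⊆_; inside; outside)
open import Data.Fin.Subset.Properties using (_⊆?_; anySubset?; drop-∷-⊆; out⊆; in⊆in)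
open import Data.Vec using (_∷_; []; here; lookup; take)
open import Data.Vec.Properties using (lookup∘tabulate)
open import Data.List using (List; []; _∷_; _++_; map; filter; length)
open import Data.List.Properties
  using (length-++; length-map; length-filter; filter-all; filter-none; filter-++)
import Data.List.Relation.Unary.All as All
open import Data.Maybe using (Maybe; just; nothing; is-just)
open import Data.Maybe.Properties using (≡-dec; just-injective)
open import Data.Product using (Σ; ∃; _×_; _,_)
open import Data.Sum using (_⊎_; inj₁; inj₂)
open import Data.Unit using (tt)
open import Relation.Binary.PropositionalEquality
  using (_≡_; _≢_; refl; sym; trans; cong; cong₂; subst; module ≡-Reasoning)
open import Relation.Nullary using (¬_; Dec; yes; no; does; ¬?)
open import Relation.Nullary.Decidable
  using (from-yes; map′; decidable-stable; _×-dec_; _⊎-dec_; _→-dec_; T?)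
open import Relation.Unary using (Pred; Decidable)

length-allSubsets : ∀ n → length (allSubsets n) ≡ 2 ^ n
length-allSubsets zero = refl
length-allSubsets (suc n) = begin
  length (map (inside ∷_) L ++ map (outside ∷_) L)
    ≡⟨ length-++ (map (inside ∷_) L) ⟩
  length (map (inside ∷_) L) + length (map (outside ∷_) L)
    ≡⟨ cong₂ _+_ (length-map _ L) (length-map _ L) ⟩
  length L + length L
    ≡⟨ cong₂ _+_ (length-allSubsets n) (trans (length-allSubsets n) (sym (+-identityʳ _))) ⟩
  2 ^ n + (2 ^ n + 0) ∎
  where
  open ≡-Reasoning
  L : List (Subset n)
  L = allSubsets n

length-filter-map : ∀ {A B : Set} {P : Pred B 0ℓ} (P? : Decidable P) (f : A → B) (xs : List A) →
  length (filter P? (map f xs)) ≡ length (filter (P? ∘ f) xs)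
length-filter-map P? f [] = refl
length-filter-map P? f (x ∷ xs) with does (P? (f x))
... | true = cong suc (length-filter-map P? f xs)
... | false = length-filter-map P? f xs

count-allSubsets-suc : ∀ {n} {P : Pred (Subset (suc n)) 0ℓ} (P? : Decidable P) →
  length (filter P? (allSubsets (suc n)))
    ≡ length (filter (P? ∘ (inside ∷_)) (allSubsets n))
      + length (filter (P? ∘ (outside ∷_)) (allSubsets n))
count-allSubsets-suc {n} P? = begin
  length (filter P? (map (inside ∷_) L ++ map (outside ∷_) L))
    ≡⟨ cong length (filter-++ P? (map (inside ∷_) L) _) ⟩
  length (filter P? (map (inside ∷_) L) ++ filter P? (map (outside ∷_) L))
    ≡⟨ length-++ (filter P? (map (inside ∷_) L)) ⟩
  length (filter P? (map (inside ∷_) L)) + length (filter P? (map (outside ∷_) L))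
    ≡⟨ cong₂ _+_ (length-filter-map P? _ L) (length-filter-map P? _ L) ⟩
  length (filter (P? ∘ (inside ∷_)) L) + length (filter (P? ∘ (outside ∷_)) L) ∎
  where
  open ≡-Reasoning
  L : List (Subset n)
  L = allSubsets n

take-⊆ : ∀ k {m} {S U : Subset (k + m)} → S ⊆ U → take k S ⊆ take k U
take-⊆ zero S⊆U = λ ()
take-⊆ (suc k) {S = outside ∷ S} {U = _ ∷ U} S⊆U = out⊆ (take-⊆ k (drop-∷-⊆ S⊆U))
take-⊆ (suc k) {S = inside ∷ S} {U = inside ∷ U} S⊆U = in⊆in (take-⊆ k (drop-∷-⊆ S⊆U))
take-⊆ (suc k) {S = inside ∷ S} {U = outside ∷ U} S⊆U with S⊆U here
... | ()

-- A property of traces on k points holds for exactly 2^m times as many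
-- sets of B_(k+m) as sets of B_k: each trace extends in 2^m ways.
-- (Induction on k; for k = 0 the property is constant.)
count-take : ∀ k m {P : Pred (Subset k) 0ℓ} (P? : Decidable P) →
  length (filter (P? ∘ take k) (allSubsets (k + m))) ≡ length (filter P? (allSubsets k)) * 2 ^ m
count-take zero m {P} P? with P? []
... | yes P[] = begin
  length (filter (λ _ → yes P[]) (allSubsets m))
    ≡⟨ cong length (filter-all {P = λ _ → P []} (λ _ → yes P[])
                                (All.universal (λ _ → P[]) (allSubsets m))) ⟩
  length (allSubsets m) ≡⟨ length-allSubsets m ⟩
  2 ^ m                 ≡⟨ sym (*-identityˡ (2 ^ m)) ⟩
  1 * 2 ^ m             ∎
  where open ≡-Reasoning
... | no ¬P[] =
  cong length (filter-none {P = λ _ → P []} (λ _ → no ¬P[])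
                           (All.universal (λ _ → ¬P[]) (allSubsets m)))
count-take (suc k) m P? = begin
  length (filter (P? ∘ take (suc k)) (allSubsets (suc (k + m))))
    ≡⟨ count-allSubsets-suc (P? ∘ take (suc k)) ⟩
  length (filter ((P? ∘ (inside ∷_)) ∘ take k) (allSubsets (k + m)))
    + length (filter ((P? ∘ (outside ∷_)) ∘ take k) (allSubsets (k + m)))
    ≡⟨ cong₂ _+_ (count-take k m (P? ∘ (inside ∷_))) (count-take k m (P? ∘ (outside ∷_))) ⟩
  withInside * 2 ^ m + withoutInside * 2 ^ m
    ≡⟨ sym (*-distribʳ-+ (2 ^ m) withInside withoutInside) ⟩
  (withInside + withoutInside) * 2 ^ m
    ≡⟨ cong (_* 2 ^ m) (sym (count-allSubsets-suc P?)) ⟩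
  length (filter P? (allSubsets (suc k))) * 2 ^ m ∎
  where
  open ≡-Reasoning
  withInside withoutInside : ℕ
  withInside = length (filter (P? ∘ (inside ∷_)) (allSubsets k))
  withoutInside = length (filter (P? ∘ (outside ∷_)) (allSubsets k))

classSize-lift : ∀ {k l} m (g : PartialColoring k l) (j : Fin l) →
  classSize (g ∘ take k {m}) j ≡ classSize g j * 2 ^ m
classSize-lift {k} m g j = count-take k m (λ T → ≡-dec _≟_ (g T) (just j))

colourCount : ∀ {A : Set} {l} → (A → Maybe (Fin l)) → Fin l → List A → ℕ
colourCount χ j xs = length (filter (λ x → ≡-dec _≟_ (χ x) (just j)) xs)

colouredCount : ∀ {A : Set} {l} → (A → Maybe (Fin l)) → List A → ℕ
colouredCount χ xs = length (filter (λ x → T? (is-just (χ x))) xs)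

dropColour : ∀ {l} → Maybe (Fin (suc l)) → Maybe (Fin l)
dropColour (just zero) = nothing
dropColour (just (suc j)) = just j
dropColour nothing = nothing

colourCount-drop : ∀ {A : Set} {l} (χ : A → Maybe (Fin (suc l))) j xs →
  colourCount χ (suc j) xs ≡ colourCount (dropColour ∘ χ) j xs
colourCount-drop χ j [] = refl
colourCount-drop χ j (x ∷ xs) with χ x
... | nothing = colourCount-drop χ j xs
... | just zero = colourCount-drop χ j xs
... | just (suc i) with does (i ≟ j)
...   | true = cong suc (colourCount-drop χ j xs)
...   | false = colourCount-drop χ j xs

colouredCount-split : ∀ {A : Set} {l} (χ : A → Maybe (Fin (suc l))) xs →
  colouredCount χ xs ≡ colourCount χ zero xs + colouredCount (dropColour ∘ χ) xs
colouredCount-split χ [] = refl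
colouredCount-split χ (x ∷ xs) with χ x
... | nothing = colouredCount-split χ xs
... | just zero = cong suc (colouredCount-split χ xs)
... | just (suc i) = trans (cong suc (colouredCount-split χ xs))
                          (sym (+-suc (colourCount χ zero xs) (colouredCount (dropColour ∘ χ) xs)))

-- Colour classes are disjoint: l classes of size ≥ k need l · k coloured members.
classes-bound : ∀ {A : Set} l (χ : A → Maybe (Fin l)) xs k →
  (∀ j → k ≤ colourCount χ j xs) → l * k ≤ colouredCount χ xs
classes-bound zero χ xs k large = z≤n
classes-bound (suc l) χ xs k large = begin
  k + l * k
    ≤⟨ +-mono-≤ (large zero) (classes-bound l (dropColour ∘ χ) xs k largeRest) ⟩
  colourCount χ zero xs + colouredCount (dropColour ∘ χ) xs
    ≡⟨ sym (colouredCount-split χ xs) ⟩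
  colouredCount χ xs ∎
  where
  open ≤-Reasoning
  largeRest : ∀ j → k ≤ colourCount (dropColour ∘ χ) j xs
  largeRest j = subst (k ≤_) (colourCount-drop χ j xs) (large (suc j))

AllClassesAtLeast-bound : ∀ {n l} (c : PartialColoring n l) k → AllClassesAtLeast c k → l * k ≤ 2 ^ n
AllClassesAtLeast-bound {n} {l} c k large = begin
  l * k                          ≤⟨ classes-bound l c (allSubsets n) k large ⟩
  colouredCount c (allSubsets n) ≤⟨ length-filter (λ S → T? (is-just (c S))) (allSubsets n) ⟩
  length (allSubsets n)          ≡⟨ length-allSubsets n ⟩
  2 ^ n                          ∎
  where open ≤-Reasoning

-- A colour assignment to the points of Fin s is rainbow if every point is
-- coloured and distinct points get distinct colours (Rainbow c G unfolds to
-- RainbowColours (c ∘ emb G)).  A clash is a witness that it is not.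
RainbowColours : ∀ {s l} → (Fin s → Maybe (Fin l)) → Set
RainbowColours {s} {l} χ =
  Σ (Fin s → Fin l) λ col → (∀ p → χ p ≡ just (col p)) × (∀ p q → p ≢ q → col p ≢ col q)

Clash : ∀ {s l} → (Fin s → Maybe (Fin l)) → Set
Clash χ = (∃ λ p → χ p ≡ nothing) ⊎ (∃ λ p → ∃ λ q → p ≢ q × χ p ≡ χ q)

clash⇒¬rainbow : ∀ {s l} {χ : Fin s → Maybe (Fin l)} → Clash χ → ¬ RainbowColours χ
clash⇒¬rainbow (inj₁ (p , χp≡nothing)) (col , coloured , distinct)
  with () ← trans (sym χp≡nothing) (coloured p)
clash⇒¬rainbow (inj₂ (p , q , p≢q , χp≡χq)) (col , coloured , distinct) =
  distinct p q p≢q (just-injective (trans (sym (coloured p)) (trans χp≡χq (coloured q))))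

Clash-cong : ∀ {s l} {χ ψ : Fin s → Maybe (Fin l)} → (∀ p → χ p ≡ ψ p) → Clash χ → Clash ψ
Clash-cong χ≗ψ (inj₁ (p , χp≡nothing)) = inj₁ (p , trans (sym (χ≗ψ p)) χp≡nothing)
Clash-cong χ≗ψ (inj₂ (p , q , p≢q , χp≡χq)) =
  inj₂ (p , q , p≢q , trans (sym (χ≗ψ p)) (trans χp≡χq (χ≗ψ q)))

clash? : ∀ {s l} (χ : Fin s → Maybe (Fin l)) → Dec (Clash χ)
clash? χ = any? (λ p → ≡-dec _≟_ (χ p) nothing)
  ⊎-dec any? (λ p → any? λ q → ¬? (p ≟ q) ×-dec ≡-dec _≟_ (χ p) (χ q))

OrderPreserving : ∀ {k} (P : FinPoset) → (Fin (size P) → Subset k) → Set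
OrderPreserving P e = ∀ p q → _≤P_ P p q → e p ⊆ e q

-- If every order-preserving P-family in B_k clashes under g, then the lift of g
-- to B_(k+m) has no rainbow strong copy of P: traces of a strong copy form an
-- order-preserving family with the same colours.
lift-noRainbow : ∀ {k l} m (P : FinPoset) (g : PartialColoring k l) →
  (∀ e → OrderPreserving P e → Clash (g ∘ e)) →
  (G : StrongCopy (k + m) P) → ¬ Rainbow (g ∘ take k) G
lift-noRainbow {k} m P g clashes G =
  clash⇒¬rainbow (clashes (take k ∘ emb G) λ p q p≤q → take-⊆ k (Equivalence.to (ord G p q) p≤q))

allSubset? : ∀ {n} {P : Pred (Subset n) 0ℓ} → Decidable P → Dec (∀ S → P S)
allSubset? P? =
  map′ (λ noCounterexample S → decidable-stable (P? S) (λ ¬PS → noCounterexample (S , ¬PS)))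
       (λ ∀P (S , ¬PS) → ¬PS (∀P S))
       (¬? (anySubset? (¬? ∘ P?)))

-- The colouring of B_3 for D_2: ∅ and [3] get colour 0, and for each i the
-- sets {i} and {i-1, i} (indices mod 3) share one of the colours 1, 2, 3.
diamondColouring : Coloring 3 4
diamondColouring (outside ∷ outside ∷ outside ∷ []) = # 0
diamondColouring (inside ∷ inside ∷ inside ∷ [])    = # 0
diamondColouring (outside ∷ outside ∷ inside ∷ [])  = # 1
diamondColouring (outside ∷ inside ∷ inside ∷ [])   = # 1
diamondColouring (outside ∷ inside ∷ outside ∷ [])  = # 2
diamondColouring (inside ∷ inside ∷ outside ∷ [])   = # 2
diamondColouring (inside ∷ outside ∷ outside ∷ [])  = # 3
diamondColouring (inside ∷ outside ∷ inside ∷ [])   = # 3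

-- The partial colouring of B_3 for {P_3, ∨_2, ∧_2}: the same classes with
-- the class {∅, [3]} left uncoloured.
middleColouring : PartialColoring 3 3
middleColouring = dropColour ∘ toPartial diamondColouring

diamondClasses : ∀ j → classSize (toPartial diamondColouring) j ≡ 2
diamondClasses zero = refl
diamondClasses (suc zero) = refl
diamondClasses (suc (suc zero)) = refl
diamondClasses (suc (suc (suc zero))) = refl

middleClasses : ∀ j → classSize middleColouring j ≡ 2
middleClasses zero = refl
middleClasses (suc zero) = refl
middleClasses (suc (suc zero)) = refl

diamondCheck : ∀ a b c d → a ⊆ b → b ⊆ d → a ⊆ c → c ⊆ d →
  Clash (toPartial diamondColouring ∘ lookup (a ∷ b ∷ c ∷ d ∷ []))
diamondCheck = from-yes (allSubset? λ a → allSubset? λ b → allSubset? λ c → allSubset? λ d →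
  a ⊆? b →-dec b ⊆? d →-dec a ⊆? c →-dec c ⊆? d →-dec
  clash? (toPartial diamondColouring ∘ lookup (a ∷ b ∷ c ∷ d ∷ [])))

veeCheck : ∀ a b c → a ⊆ b → a ⊆ c → Clash (middleColouring ∘ lookup (a ∷ b ∷ c ∷ []))
veeCheck = from-yes (allSubset? λ a → allSubset? λ b → allSubset? λ c →
  a ⊆? b →-dec a ⊆? c →-dec clash? (middleColouring ∘ lookup (a ∷ b ∷ c ∷ [])))

wedgeCheck : ∀ a b c → b ⊆ a → c ⊆ a → Clash (middleColouring ∘ lookup (a ∷ b ∷ c ∷ []))
wedgeCheck = from-yes (allSubset? λ a → allSubset? λ b → allSubset? λ c →
  b ⊆? a →-dec c ⊆? a →-dec clash? (middleColouring ∘ lookup (a ∷ b ∷ c ∷ [])))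

-- The checks cover all order-preserving families, since e is determined by its
-- values: e p = lookup (tabulate e) p.
diamondClash : ∀ e → OrderPreserving D2 e → Clash (toPartial diamondColouring ∘ e)
diamondClash e ≤⇒⊆ =
  Clash-cong (λ p → cong (toPartial diamondColouring) (lookup∘tabulate e p))
    (diamondCheck (e (# 0)) (e (# 1)) (e (# 2)) (e (# 3))
      (≤⇒⊆ (# 0) (# 1) tt) (≤⇒⊆ (# 1) (# 3) tt)
      (≤⇒⊆ (# 0) (# 2) tt) (≤⇒⊆ (# 2) (# 3) tt))

-- A chain is in particular ∨-shaped (0 ≤ 1 and 0 ≤ 2).
chainClash : ∀ e → OrderPreserving P3 e → Clash (middleColouring ∘ e)
chainClash e ≤⇒⊆ =
  Clash-cong (λ p → cong middleColouring (lookup∘tabulate e p))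
    (veeCheck (e (# 0)) (e (# 1)) (e (# 2)) (≤⇒⊆ (# 0) (# 1) z≤n) (≤⇒⊆ (# 0) (# 2) z≤n))

veeClash : ∀ e → OrderPreserving Vee2 e → Clash (middleColouring ∘ e)
veeClash e ≤⇒⊆ =
  Clash-cong (λ p → cong middleColouring (lookup∘tabulate e p))
    (veeCheck (e (# 0)) (e (# 1)) (e (# 2)) (≤⇒⊆ (# 0) (# 1) tt) (≤⇒⊆ (# 0) (# 2) tt))

wedgeClash : ∀ e → OrderPreserving Wedge2 e → Clash (middleColouring ∘ e)
wedgeClash e ≤⇒⊆ =
  Clash-cong (λ p → cong middleColouring (lookup∘tabulate e p))
    (wedgeCheck (e (# 0)) (e (# 1)) (e (# 2)) (≤⇒⊆ (# 1) (# 0) tt) (≤⇒⊆ (# 2) (# 0) tt))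

lift-classes : ∀ {l} m (g : PartialColoring 3 l) → (∀ j → classSize g j ≡ 2) →
  AllClassesAtLeast (g ∘ take 3 {m}) (2 ^ suc m)
lift-classes m g pairs j =
  ≤-reflexive (sym (trans (classSize-lift m g j) (cong (_* 2 ^ m) (pairs j))))

fourClasses-bound : ∀ m (c : PartialColoring (3 + m) 4) k → AllClassesAtLeast c k → k ≤ 2 ^ suc m
fourClasses-bound m c k large =
  *-cancelˡ-≤ 4 (subst (4 * k ≤_) (sym (*-assoc 2 2 (2 ^ suc m)))
                        (AllClassesAtLeast-bound c k large))

proposition3 : (n : ℕ) → 3 ≤ n →
    fAdmissible n 3 (P3 ∷ Vee2 ∷ Wedge2 ∷ []) (2 ^ (n ∸ 2))
    × (FIs n 4 (D2 ∷ []) (2 ^ (n ∸ 2)) × fIs n 4 (D2 ∷ []) (2 ^ (n ∸ 2)))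
proposition3 (suc zero) (s≤s ())
proposition3 (suc (suc zero)) (s≤s (s≤s ()))
proposition3 (suc (suc (suc m))) _ =
    (middleColouring ∘ take 3 , noRainbowMiddle , lift-classes m middleColouring middleClasses)
  , ((diamondColouring ∘ take 3 , noRainbowDiamond , diamondLarge)
      , λ k (c , _ , large) → fourClasses-bound m (toPartial c) k large)
  , ((toPartial diamondColouring ∘ take 3 , noRainbowDiamond , diamondLarge)
      , λ k (c , _ , large) → fourClasses-bound m c k large)
  where
  noRainbowMiddle : NoRainbow (P3 ∷ Vee2 ∷ Wedge2 ∷ []) (middleColouring ∘ take 3 {m})
  noRainbowMiddle = lift-noRainbow m P3 middleColouring chainClash
                  , lift-noRainbow m Vee2 middleColouring veeClash
                  , lift-noRainbow m Wedge2 middleColouring wedgeClash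
                  , tt
  noRainbowDiamond : NoRainbow (D2 ∷ []) (toPartial diamondColouring ∘ take 3 {m})
  noRainbowDiamond = lift-noRainbow m D2 (toPartial diamondColouring) diamondClash , tt
  diamondLarge : AllClassesAtLeast (toPartial diamondColouring ∘ take 3 {m}) (2 ^ suc m)
  diamondLarge = lift-classes m (toPartial diamondColouring) diamondClasses
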